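{- Let $T$ be a tree of order $n\ge 2$, and let $P_n$ denote the path on $n$ vertices. Then $cfc(T)\ge cfc(P_n)=\lceil \log_2 n\rceil$.
   Context: For an edge-colored graph, a path is conflict-free if some color occurs on exactly one of its edges. An edge-coloring of a connected graph $G$ is a conflict-free connection coloring if every pair of distinct vertices is joined by a conflict-free path; $cfc(G)$ is the minimum number of colors in such a coloring. -}

module Defs where

open import Data.Nat using (ℕ; zero; suc; pred; _≤_)
open import Data.Fin using (Fin; toℕ) renaming (_≟_ to _≟ᶠ_)
open import Data.List using (List; []; _∷_; length; filter)
open import Data.List.Relation.Unary.Unique.Propositional using (Unique)
open import Data.Product using (Σ; ∃; _×_; _,_)
open import Data.Sum using (_⊎_; inj₁; inj₂)
open import Relation.Nullary using (¬_)
open import Relation.Binary.PropositionalEquality using (_≡_; _≢_; sym; trans; cong)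

n≢1+n : ∀ m → m ≢ suc m
n≢1+n zero ()
n≢1+n (suc m) e = n≢1+n m (cong pred e)

record Graph (n : ℕ) : Set₁ where
  field
    Adj    : Fin n → Fin n → Set
    symm   : ∀ {u v} → Adj u v → Adj v u
    irrefl : ∀ {u} → ¬ Adj u u
open Graph public

data Walk {n : ℕ} (G : Graph n) : Fin n → Fin n → Set where
  stop : ∀ u → Walk G u u
  step : ∀ {u w v} → Adj G u w → Walk G w v → Walk G u v

vertices : ∀ {n} {G : Graph n} {u v} → Walk G u v → List (Fin n)
vertices (stop u) = u ∷ []
vertices (step {u = u} _ p) = u ∷ vertices p

IsPath : ∀ {n} {G : Graph n} {u v} → Walk G u v → Set
IsPath p = Unique (vertices p)

Connected : ∀ {n} → Graph n → Set
Connected G = ∀ u v → Walk G u v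

HasCycle : ∀ {n} → Graph n → Set
HasCycle G = Σ _ λ u → Σ _ λ v → Σ (Walk G u v) λ p →
  IsPath p × (3 ≤ length (vertices p)) × Adj G v u

IsTree : ∀ {n} → Graph n → Set
IsTree G = Connected G × ¬ HasCycle G

EdgeColouring : ∀ {n} → Graph n → ℕ → Set
EdgeColouring {n} G k = Fin n → Fin n → Fin k

WellDefined : ∀ {n k} {G : Graph n} → EdgeColouring G k → Set
WellDefined {G = G} c = ∀ u v → Adj G u v → c u v ≡ c v u

colours : ∀ {n k} {G : Graph n} → EdgeColouring G k → ∀ {u v} → Walk G u v → List (Fin k)
colours c (stop _) = []
colours c (step {u = u} {w = w} _ p) = c u w ∷ colours c p

ConflictFree : ∀ {k} → List (Fin k) → Set
ConflictFree {k} cs = Σ (Fin k) λ a → length (filter (a ≟ᶠ_) cs) ≡ 1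

IsCFCColouring : ∀ {n k} (G : Graph n) → EdgeColouring G k → Set
IsCFCColouring G c = WellDefined {G = G} c ×
  (∀ u v → u ≢ v → Σ (Walk G u v) λ p → IsPath p × ConflictFree (colours c p))

CFCColourable : ∀ {n} → Graph n → ℕ → Set
CFCColourable G k = Σ (EdgeColouring G k) λ c → IsCFCColouring G c

IsCfc : ∀ {n} → Graph n → ℕ → Set
IsCfc G k = CFCColourable G k × (∀ k′ → CFCColourable G k′ → k ≤ k′)

PathAdj : ∀ {n} → Fin n → Fin n → Set
PathAdj i j = (toℕ j ≡ suc (toℕ i)) ⊎ (toℕ i ≡ suc (toℕ j))

pathGraph : (n : ℕ) → Graph n
pathGraph n = record
  { Adj = PathAdj
  ; symm = λ { (inj₁ e) → inj₂ e ; (inj₂ e) → inj₁ e }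
  ; irrefl = λ { {u} (inj₁ e) → n≢1+n (toℕ u) e ; {u} (inj₂ e) → n≢1+n (toℕ u) e }
  }

module Submission where

-- Lower bound: an acyclic graph on n vertices with a CFC colouring in k
-- colours has n ≤ 2ᵏ.  Give each walk its parity vector (which colours it
-- uses an odd number of times).  In an acyclic graph pruning backtracks turns
-- any walk into a path without changing parities, so closed walks are even
-- and walks with the same ends have equal parities.  The parity vector of a
-- walk from a fixed root to v is thus a potential of v in Boolᵏ, and the
-- odd colour on a conflict-free u–v path separates the potentials of u and v.
--
-- Upper bound: colour the edge {i, i+1} of Pₙ by the ruler sequence
-- (ruler (k+1) = ruler k, new colour, ruler k), every nonempty segment of
-- which has a colour occurring once; monotone paths in Pₙ carry segments.
-- Pₙ is acyclic, so the lower bound applies to it as well as to T.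

open import Defs
open import Data.Bool using (Bool; true; false; not; _xor_)
open import Data.Bool.Properties using (not-distribˡ-xor; not-involutive; xor-assoc; xor-identityʳ)
open import Data.Empty using (⊥-elim)
open import Data.Fin using (Fin; toℕ; fromℕ; fromℕ<; inject₁; funToFin; finToFun)
  renaming (_≟_ to _≟ᶠ_; zero to fzero)
open import Data.Fin.Properties
  using (toℕ-injective; toℕ<n; toℕ-fromℕ<; fromℕ≢inject₁; inject₁-injective;
         finToFun-funToFin; injective⇒≤; 2↔Bool)
open import Data.List using (List; []; _∷_; _++_; [_]; length; filter; map; take; applyDownFrom)
open import Data.List.Properties using (filter-++; length-++)
open import Data.List.Membership.Propositional using (_∈_)
open import Data.List.Relation.Unary.All using (All; []; _∷_)
import Data.List.Relation.Unary.All as All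
import Data.List.Relation.Unary.All.Properties as All
open import Data.List.Relation.Unary.AllPairs using ([]; _∷_)
open import Data.List.Relation.Unary.Any using (here; there; any?)
open import Data.List.Relation.Unary.Unique.Propositional using (Unique)
import Data.List.Relation.Unary.Unique.Propositional.Properties as Unique
open import Data.Nat hiding (parity)
open import Data.Nat.Induction using (<-rec)
open import Data.Nat.Logarithm using (⌈log₂_⌉; ⌈log₂⌉-mono-≤; ⌈log₂2^n⌉≡n; ⌈log₂⌈n/2⌉⌉≡⌈log₂n⌉∸1)
open import Data.Nat.Properties
open import Data.Product using (Σ; _×_; _,_; proj₁; proj₂)
open import Data.Sum using (inj₁; inj₂)
open import Function using (_∘_; Injective; Inverse)
open import Relation.Binary using (tri<; tri≈; tri>)
open import Relation.Binary.PropositionalEquality hiding ([_])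
open import Relation.Nullary using (¬_; yes; no)

odd : ℕ → Bool
odd zero    = false
odd (suc n) = not (odd n)

odd-+ : ∀ m n → odd (m + n) ≡ odd m xor odd n
odd-+ zero    n = refl
odd-+ (suc m) n = trans (cong not (odd-+ m n)) (not-distribˡ-xor (odd m) (odd n))

count : ∀ {k} → Fin k → List (Fin k) → ℕ
count t cs = length (filter (t ≟ᶠ_) cs)

count-++ : ∀ {k} (t : Fin k) xs ys → count t (xs ++ ys) ≡ count t xs + count t ys
count-++ t xs ys = trans (cong length (filter-++ (t ≟ᶠ_) xs ys)) (length-++ (filter (t ≟ᶠ_) xs))

count-here : ∀ {k} (t : Fin k) xs → count t (t ∷ xs) ≡ suc (count t xs)
count-here t xs with t ≟ᶠ t
... | yes _   = refl
... | no t≢t = ⊥-elim (t≢t refl)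

count-there : ∀ {k} {t x : Fin k} xs → t ≢ x → count t (x ∷ xs) ≡ count t xs
count-there {t = t} {x} xs t≢x with t ≟ᶠ x
... | yes t≡x = ⊥-elim (t≢x t≡x)
... | no _    = refl

count-map : ∀ {k m} {f : Fin k → Fin m} → Injective _≡_ _≡_ f →
            ∀ t xs → count (f t) (map f xs) ≡ count t xs
count-map f-inj t [] = refl
count-map {f = f} f-inj t (x ∷ xs) with t ≟ᶠ x
... | yes refl = trans (count-here (f t) (map f xs)) (cong suc (count-map f-inj t xs))
... | no t≢x  = trans (count-there (map f xs) (t≢x ∘ f-inj)) (count-map f-inj t xs)

conflictFree-map : ∀ {k m} {f : Fin k → Fin m} → Injective _≡_ _≡_ f →
                   ∀ cs → ConflictFree cs → ConflictFree (map f cs)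
conflictFree-map {f = f} f-inj cs (t , once) = f t , trans (count-map f-inj t cs) once

parity : ∀ {k} → Fin k → List (Fin k) → Bool
parity t cs = odd (count t cs)

parity-++ : ∀ {k} (t : Fin k) xs ys → parity t (xs ++ ys) ≡ parity t xs xor parity t ys
parity-++ t xs ys = trans (cong odd (count-++ t xs ys)) (odd-+ (count t xs) (count t ys))

xor-swap : ∀ h x y → x xor (h xor y) ≡ (h xor x) xor y
xor-swap false x     y = refl
xor-swap true  false y = refl
xor-swap true  true  y = not-involutive y

xor-cancel : ∀ h x y → (h xor x) xor (h xor y) ≡ x xor y
xor-cancel false x     y = refl
xor-cancel true  false y = not-involutive y
xor-cancel true  true  y = refl

xor≡false⇒≡ : ∀ x y → x xor y ≡ false → x ≡ y
xor≡false⇒≡ false false _ = refl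
xor≡false⇒≡ true  true  _ = refl

xor-true-≢ : ∀ x → x xor true ≢ x
xor-true-≢ false ()
xor-true-≢ true  ()

module _ {n : ℕ} {G : Graph n} where

  infixr 5 _▹_
  _▹_ : ∀ {u v w} → Walk G u v → Walk G v w → Walk G u w
  stop _   ▹ q = q
  step e p ▹ q = step e (p ▹ q)

  first∈ : ∀ {u v} (p : Walk G u v) → u ∈ vertices p
  first∈ (stop _)   = here refl
  first∈ (step _ _) = here refl

  last∈ : ∀ {u v} (p : Walk G u v) → v ∈ vertices p
  last∈ (stop _)   = here refl
  last∈ (step _ p) = there (last∈ p)

  vertices-nonempty : ∀ {u v} (p : Walk G u v) → 1 ≤ length (vertices p)
  vertices-nonempty (stop _)   = s≤s z≤n
  vertices-nonempty (step _ _) = s≤s z≤n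

  prefix : ∀ {z x v} (q : Walk G z x) → v ∈ vertices q →
           Σ (Walk G z v) λ r → Σ ℕ λ m → vertices r ≡ take m (vertices q)
  prefix (stop _)   (here refl) = stop _ , 1 , refl
  prefix (step _ _) (here refl) = stop _ , 1 , refl
  prefix (step e q) (there v∈q) with prefix q v∈q
  ... | r , m , r≡ = step e r , suc m , cong (_ ∷_) r≡

  closes-cycle : ∀ {u z x v} (e : Adj G u v) (e′ : Adj G u z) (p : Walk G z x) →
                 IsPath (step e′ p) → v ∈ vertices p → z ≢ v → HasCycle G
  closes-cycle e e′ p (u∉p ∷ p-path) v∈p z≢v with prefix p v∈p
  ... | stop _     , _ , _  = ⊥-elim (z≢v refl)
  ... | step e″ r , m , r≡ =
    _ , _ , step e′ (step e″ r) ,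
    (subst (All _) (sym r≡) (All.take⁺ m u∉p) ∷ subst Unique (sym r≡) (Unique.take⁺ m p-path)) ,
    s≤s (s≤s (vertices-nonempty r)) , symm G e

  cfc⇒connected : ∀ {k} {c : EdgeColouring G k} → IsCFCColouring G c → Connected G
  cfc⇒connected (_ , cf) u v with u ≟ᶠ v
  ... | yes refl = stop u
  ... | no u≢v   = proj₁ (cf u v u≢v)

-- Colour parities of walks; in an acyclic graph they depend only on the ends.

module WalkParity {n k : ℕ} {G : Graph n} (c : EdgeColouring G k) where

  parityOf : ∀ {u v} → Walk G u v → Fin k → Bool
  parityOf p t = parity t (colours c p)

  parity-step : ∀ {u w v} (e : Adj G u w) (p : Walk G w v) t →
                parityOf (step e p) t ≡ parity t [ c u w ] xor parityOf p t
  parity-step {u} {w} e p t = parity-++ t [ c u w ] (colours c p)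

  parity-▹ : ∀ {u v w} (p : Walk G u v) (q : Walk G v w) t →
             parityOf (p ▹ q) t ≡ parityOf p t xor parityOf q t
  parity-▹ (stop _) q t = refl
  parity-▹ (step e p) q t = begin
    parityOf (step e (p ▹ q)) t                          ≡⟨ parity-step e (p ▹ q) t ⟩
    parity t [ _ ] xor parityOf (p ▹ q) t                ≡⟨ cong (parity t [ _ ] xor_) (parity-▹ p q t) ⟩
    parity t [ _ ] xor (parityOf p t xor parityOf q t)   ≡⟨ sym (xor-assoc (parity t [ _ ]) _ _) ⟩
    (parity t [ _ ] xor parityOf p t) xor parityOf q t   ≡⟨ cong (_xor parityOf q t) (sym (parity-step e p t)) ⟩
    parityOf (step e p) t xor parityOf q t               ∎
    where open ≡-Reasoning

  module Acyclic (wd : WellDefined {G = G} c) (acyclic : ¬ HasCycle G) where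

    -- Prune the walk w⁻¹ followed by the path p into a path with the same
    -- parities: each step of w either extends the path or, in an acyclic
    -- graph necessarily, retraces its last edge, which cancels in parity.
    prune : ∀ {u y x} (w : Walk G u y) (p : Walk G u x) → IsPath p →
            Σ (Walk G y x) λ q → IsPath q × (∀ t → parityOf q t ≡ parityOf w t xor parityOf p t)
    prune (stop _) p p-path = p , p-path , λ _ → refl
    prune (step {w = v} e w) p p-path with any? (v ≟ᶠ_) (vertices p)
    prune {u} (step {w = v} e w) p p-path | no v∉p
      with prune w (step (symm G e) p) (All.¬Any⇒All¬ _ v∉p ∷ p-path)
    ... | q , q-path , q-parity = q , q-path , λ t → trans (q-parity t) (extend t)
      where
      open ≡-Reasoning
      extend : ∀ t → parityOf w t xor parityOf (step (symm G e) p) t ≡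
                     parityOf (step e w) t xor parityOf p t
      extend t = begin
        parityOf w t xor parityOf (step (symm G e) p) t
          ≡⟨ cong (parityOf w t xor_) (parity-step (symm G e) p t) ⟩
        parityOf w t xor (parity t [ c v u ] xor parityOf p t)
          ≡⟨ cong (λ a → parityOf w t xor (parity t [ a ] xor parityOf p t)) (sym (wd u v e)) ⟩
        parityOf w t xor (parity t [ c u v ] xor parityOf p t)
          ≡⟨ xor-swap (parity t [ c u v ]) (parityOf w t) (parityOf p t) ⟩
        (parity t [ c u v ] xor parityOf w t) xor parityOf p t
          ≡⟨ cong (_xor parityOf p t) (sym (parity-step e w t)) ⟩
        parityOf (step e w) t xor parityOf p t ∎
    prune (step e w) (stop _) _ | yes (here refl) = ⊥-elim (irrefl G e)
    prune (step {w = v} e w) (step {w = z} e′ p) (_ ∷ p-path) | yes _ with z ≟ᶠ v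
    prune {u} (step e w) (step {w = z} e′ p) (_ ∷ p-path) | yes _ | yes refl with prune w p p-path
    ... | q , q-path , q-parity = q , q-path , λ t → trans (q-parity t) (retract t)
      where
      open ≡-Reasoning
      -- w returns along the last edge u z of the path, which thus cancels.
      retract : ∀ t → parityOf w t xor parityOf p t ≡ parityOf (step e w) t xor parityOf (step e′ p) t
      retract t = begin
        parityOf w t xor parityOf p t
          ≡⟨ sym (xor-cancel (parity t [ c u z ]) (parityOf w t) (parityOf p t)) ⟩
        (parity t [ c u z ] xor parityOf w t) xor (parity t [ c u z ] xor parityOf p t)
          ≡⟨ sym (cong₂ _xor_ (parity-step e w t) (parity-step e′ p t)) ⟩
        parityOf (step e w) t xor parityOf (step e′ p) t ∎
    prune (step e w) (step e′ p) _ | yes (here refl) | no _ = ⊥-elim (irrefl G e)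
    prune (step e w) (step e′ p) p-path | yes (there v∈p) | no z≢v =
      ⊥-elim (acyclic (closes-cycle e e′ p p-path v∈p z≢v))

    closed-even : ∀ {x} (w : Walk G x x) t → parityOf w t ≡ false
    closed-even {x} w t with prune w (stop x) ([] ∷ [])
    ... | stop _   , _           , q-parity = trans (sym (xor-identityʳ _)) (sym (q-parity t))
    ... | step _ q , (x∉q ∷ _) , _        = ⊥-elim (All.lookup x∉q (last∈ q) refl)

    parity-unique : ∀ {r v} (w₁ w₂ : Walk G r v) t → parityOf w₁ t ≡ parityOf w₂ t
    parity-unique {r} w₁ w₂ t with prune w₁ (stop r) ([] ∷ [])
    ... | q , _ , q-parity = begin
      parityOf w₁ t                ≡⟨ sym (xor-identityʳ _) ⟩
      parityOf w₁ t xor false      ≡⟨ sym (q-parity t) ⟩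
      parityOf q t                 ≡⟨ sym (xor≡false⇒≡ (parityOf w₂ t) (parityOf q t) w₂q-even) ⟩
      parityOf w₂ t                ∎
      where
      open ≡-Reasoning
      w₂q-even : parityOf w₂ t xor parityOf q t ≡ false
      w₂q-even = trans (sym (parity-▹ w₂ q t)) (closed-even (w₂ ▹ q) t)

-- The lower bound: n ≤ 2ᵏ for a CFC colouring of an acyclic graph with k colours.

encode-Bool : ∀ {k} → (Fin k → Bool) → Fin (2 ^ k)
encode-Bool f = funToFin (from ∘ f)
  where open Inverse 2↔Bool

encode-Bool-injective : ∀ {k} {f g : Fin k → Bool} → encode-Bool f ≡ encode-Bool g → ∀ t → f t ≡ g t
encode-Bool-injective {f = f} {g} eq t = begin
  f t                              ≡⟨ sym (strictlyInverseˡ (f t)) ⟩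
  to (from (f t))                  ≡⟨ cong to (sym (finToFun-funToFin (from ∘ f) t)) ⟩
  to (finToFun (encode-Bool f) t)  ≡⟨ cong (λ x → to (finToFun x t)) eq ⟩
  to (finToFun (encode-Bool g) t)  ≡⟨ cong to (finToFun-funToFin (from ∘ g) t) ⟩
  to (from (g t))                  ≡⟨ strictlyInverseˡ (g t) ⟩
  g t                              ∎
  where
  open ≡-Reasoning
  open Inverse 2↔Bool

module _ {n k : ℕ} {G : Graph n} (acyclic : ¬ HasCycle G)
         (c : EdgeColouring G k) (cfc : IsCFCColouring G c) where

  open WalkParity {G = G} c
  open Acyclic (proj₁ cfc) acyclic

  -- Distinct vertices have distinct potentials (parity vectors of walks from a root r):
  -- a walk r → u followed by a conflict-free u–v path has the parities of any walk r → v.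
  potentials-separate : ∀ r u v → u ≢ v → Σ (Fin k) λ t →
    parityOf (cfc⇒connected cfc r u) t ≢ parityOf (cfc⇒connected cfc r v) t
  potentials-separate r u v u≢v with proj₂ cfc u v u≢v
  ... | p , _ , t , once = t , λ same → xor-true-≢ (parityOf walk-u t) (begin
    parityOf walk-u t xor true           ≡⟨ cong (parityOf walk-u t xor_) (sym (cong odd once)) ⟩
    parityOf walk-u t xor parityOf p t   ≡⟨ sym (parity-▹ walk-u p t) ⟩
    parityOf (walk-u ▹ p) t              ≡⟨ parity-unique (walk-u ▹ p) walk-v t ⟩
    parityOf walk-v t                    ≡⟨ sym same ⟩
    parityOf walk-u t                    ∎)
    where
    open ≡-Reasoning
    walk-u : Walk G r u
    walk-u = cfc⇒connected cfc r u
    walk-v : Walk G r v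
    walk-v = cfc⇒connected cfc r v

-- Potentials encode the vertices injectively into Boolᵏ.
acyclic-cfc-bound : ∀ {n k} {G : Graph n} → ¬ HasCycle G → CFCColourable G k → n ≤ 2 ^ k
acyclic-cfc-bound {zero}  _ _ = z≤n
acyclic-cfc-bound {suc m} {k} {G} acyclic (c , cfc) = injective⇒≤ encode-injective
  where
  open WalkParity {G = G} c
  potential : Fin (suc m) → Fin k → Bool
  potential v = parityOf (cfc⇒connected cfc fzero v)
  encode-injective : Injective _≡_ _≡_ (encode-Bool ∘ potential)
  encode-injective {u} {v} eq with u ≟ᶠ v
  ... | yes u≡v = u≡v
  ... | no u≢v with potentials-separate acyclic c cfc fzero u v u≢v
  ...   | t , differ = ⊥-elim (differ (encode-Bool-injective eq t))

-- The ruler sequence and its conflict-free segments.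

segment : ∀ {A : Set} → (ℕ → A) → ℕ → ℕ → List A
segment f a zero    = []
segment f a (suc d) = f a ∷ segment f (suc a) d

segment-snoc : ∀ {A : Set} (f : ℕ → A) a d → segment f a (suc d) ≡ segment f a d ++ [ f (a + d) ]
segment-snoc f a zero    = cong (λ i → [ f i ]) (sym (+-identityʳ a))
segment-snoc f a (suc d) =
  cong (f a ∷_) (trans (segment-snoc f (suc a) d) (cong (λ i → segment f (suc a) d ++ [ f i ]) (sym (+-suc a d))))

count-backwards : ∀ {k} (t : Fin k) f a d →
                  count t (applyDownFrom (λ i → f (a + i)) d) ≡ count t (segment f a d)
count-backwards     t f a zero    = refl
count-backwards {k} t f a (suc d) = begin
  count t ([ f (a + d) ] ++ backwards)             ≡⟨ count-++ t [ f (a + d) ] backwards ⟩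
  count t [ f (a + d) ] + count t backwards        ≡⟨ cong (count t [ f (a + d) ] +_) (count-backwards t f a d) ⟩
  count t [ f (a + d) ] + count t (segment f a d)  ≡⟨ +-comm (count t [ f (a + d) ]) _ ⟩
  count t (segment f a d) + count t [ f (a + d) ]  ≡⟨ sym (count-++ t (segment f a d) [ f (a + d) ]) ⟩
  count t (segment f a d ++ [ f (a + d) ])         ≡⟨ cong (count t) (sym (segment-snoc f a d)) ⟩
  count t (segment f a (suc d))                    ∎
  where
  open ≡-Reasoning
  backwards : List (Fin k)
  backwards = applyDownFrom (λ i → f (a + i)) d

segment-absent : ∀ {k} {t : Fin k} f a d → (∀ i → a ≤ i → t ≢ f i) → count t (segment f a d) ≡ 0
segment-absent f a zero    _      = refl
segment-absent f a (suc d) absent =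
  trans (count-there (segment f (suc a) d) (absent a ≤-refl))
        (segment-absent f (suc a) d λ i a<i → absent i (≤-trans (n≤1+n a) a<i))

-- rulerLength k = 2^(k+1) - 1 is the length of ruler k.
rulerLength : ℕ → ℕ
rulerLength zero    = 1
rulerLength (suc k) = suc (rulerLength k + rulerLength k)

rulerLength≡2^-1 : ∀ k → suc (rulerLength k) ≡ 2 ^ suc k
rulerLength≡2^-1 zero    = refl
rulerLength≡2^-1 (suc k) = begin
  suc (suc (rulerLength k + rulerLength k))  ≡⟨ cong suc (sym (+-suc (rulerLength k) (rulerLength k))) ⟩
  suc (rulerLength k) + suc (rulerLength k)  ≡⟨ cong₂ _+_ (rulerLength≡2^-1 k) (rulerLength≡2^-1 k) ⟩
  2 ^ suc k + 2 ^ suc k                      ≡⟨ cong (2 ^ suc k +_) (sym (+-identityʳ (2 ^ suc k))) ⟩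
  2 ^ suc (suc k)                            ∎
  where open ≡-Reasoning

-- ruler (k+1) = ruler k, new colour k+1, ruler k.
ruler : ∀ k → ℕ → Fin (suc k)
ruler zero    _ = fzero
ruler (suc k) j with <-cmp j (rulerLength k)
... | tri< _ _ _ = inject₁ (ruler k j)
... | tri≈ _ _ _ = fromℕ (suc k)
... | tri> _ _ _ = inject₁ (ruler k (j ∸ suc (rulerLength k)))

ruler-lower : ∀ k j → j < rulerLength k → ruler (suc k) j ≡ inject₁ (ruler k j)
ruler-lower k j j<M with <-cmp j (rulerLength k)
... | tri< _ _ _   = refl
... | tri≈ j≮M _ _ = ⊥-elim (j≮M j<M)
... | tri> j≮M _ _ = ⊥-elim (j≮M j<M)

ruler-upper : ∀ k j → ruler (suc k) (suc (rulerLength k) + j) ≡ inject₁ (ruler k j)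
ruler-upper k j with <-cmp (suc (rulerLength k) + j) (rulerLength k)
... | tri< M+j<M _ _ = ⊥-elim (<⇒≱ M+j<M (≤-trans (n≤1+n _) (m≤m+n (suc (rulerLength k)) j)))
... | tri≈ _ M+j≡M _ = ⊥-elim (m≢1+m+n (rulerLength k) (sym M+j≡M))
... | tri> _ _ _     = cong (inject₁ ∘ ruler k) (m+n∸m≡n (suc (rulerLength k)) j)

ruler-new-colour : ∀ k j → j ≢ rulerLength k → fromℕ (suc k) ≢ ruler (suc k) j
ruler-new-colour k j j≢M with <-cmp j (rulerLength k)
... | tri< _ _ _   = fromℕ≢inject₁
... | tri≈ _ j≡M _ = ⊥-elim (j≢M j≡M)
... | tri> _ _ _   = fromℕ≢inject₁

lower-half : ∀ k a d → a + d ≤ rulerLength k →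
             segment (ruler (suc k)) a d ≡ map inject₁ (segment (ruler k) a d)
lower-half k a zero    _     = refl
lower-half k a (suc d) bound =
  cong₂ _∷_ (ruler-lower k a (≤-trans (s≤s (m≤m+n a d)) bound′)) (lower-half k (suc a) d bound′)
  where
  bound′ : suc a + d ≤ rulerLength k
  bound′ = subst (_≤ rulerLength k) (+-suc a d) bound

upper-half : ∀ k a d → segment (ruler (suc k)) (suc (rulerLength k) + a) d ≡ map inject₁ (segment (ruler k) a d)
upper-half k a zero    = refl
upper-half k a (suc d) =
  cong₂ _∷_ (ruler-upper k a)
            (trans (cong (λ i → segment (ruler (suc k)) i d) (sym (+-suc (suc (rulerLength k)) a)))
                   (upper-half k (suc a) d))

straddling : ∀ k a d → a ≤ rulerLength k → rulerLength k < a + d →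
             count (fromℕ (suc k)) (segment (ruler (suc k)) a d) ≡ 1
straddling k a zero    a≤M M<a+0 = ⊥-elim (<⇒≱ M<a+0 (subst (_≤ _) (sym (+-identityʳ a)) a≤M))
straddling k a (suc d) a≤M M<a+d with <-cmp a (rulerLength k)
... | tri< a<M _ _ = trans (count-there (segment (ruler (suc k)) (suc a) d) (fromℕ≢inject₁ {i = ruler k a}))
                          (straddling k (suc a) d a<M (subst (rulerLength k <_) (+-suc a d) M<a+d))
... | tri≈ _ a≡M _ = trans (count-here new rest) (cong suc (segment-absent (ruler (suc k)) (suc a) d beyond))
  where
  new : Fin (suc (suc k))
  new = fromℕ (suc k)
  rest : List (Fin (suc (suc k)))
  rest = segment (ruler (suc k)) (suc a) d
  beyond : ∀ i → suc a ≤ i → new ≢ ruler (suc k) i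
  beyond i a<i = ruler-new-colour k i (λ i≡M → <-irrefl (trans a≡M (sym i≡M)) a<i)
... | tri> _ _ a>M = ⊥-elim (<⇒≱ a>M a≤M)

ruler-conflict-free : ∀ k a d → 0 < d → a + d ≤ rulerLength k → ConflictFree (segment (ruler k) a d)
ruler-conflict-free zero zero    (suc zero)    _ _               = fzero , refl
ruler-conflict-free zero zero    (suc (suc _)) _ (s≤s ())
ruler-conflict-free zero (suc a) (suc d)       _ (s≤s a+1+d≤0) =
  ⊥-elim (1+n≢0 (trans (sym (+-suc a d)) (n≤0⇒n≡0 a+1+d≤0)))
ruler-conflict-free (suc k) a d 0<d bound with a + d ≤? rulerLength k
... | yes in-lower =
  subst (ConflictFree {suc (suc k)}) (sym (lower-half k a d in-lower))
        (conflictFree-map inject₁-injective (segment (ruler k) a d) (ruler-conflict-free k a d 0<d in-lower))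
... | no not-lower with a ≤? rulerLength k
...   | yes a≤M = fromℕ (suc k) , straddling k a d a≤M (≰⇒> not-lower)
...   | no a≰M with m≤n⇒∃[o]m+o≡n (≰⇒> a≰M)
...     | a′ , refl =
  subst (ConflictFree {suc (suc k)}) (sym (upper-half k a′ d))
        (conflictFree-map inject₁-injective (segment (ruler k) a′ d) (ruler-conflict-free k a′ d 0<d in-upper))
  where
  in-upper : a′ + d ≤ rulerLength k
  in-upper = +-cancelˡ-≤ (rulerLength k) _ _
               (subst (_≤ rulerLength k + rulerLength k) (+-assoc (rulerLength k) a′ d) (s≤s⁻¹ bound))

-- The path Pₙ: acyclicity and monotone paths.

module _ {n : ℕ} where

  -- A path of Pₙ whose first step goes up keeps going up, so it ends
  -- (number of vertices after the start) places above its start.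
  rising-end : ∀ {u w v : Fin n} → toℕ w ≡ suc (toℕ u) → (q : Walk (pathGraph n) w v) →
               Unique (u ∷ vertices q) → toℕ v ≡ toℕ u + length (vertices q)
  rising-end {u = u} w≡1+u (stop _) _ = trans w≡1+u (+-comm 1 (toℕ u))
  rising-end {u = u} w≡1+u (step (inj₁ w′≡1+w) q) (_ ∷ q-path) =
    trans (rising-end w′≡1+w q q-path)
          (trans (cong (_+ length (vertices q)) w≡1+u) (sym (+-suc (toℕ u) _)))
  rising-end {u = u} w≡1+u (step (inj₂ w≡1+w′) q) ((_ ∷ u∉q) ∷ _) =
    ⊥-elim (All.lookup u∉q (first∈ q) (toℕ-injective (suc-injective (trans (sym w≡1+u) w≡1+w′))))

  falling-end : ∀ {u w v : Fin n} → toℕ u ≡ suc (toℕ w) → (q : Walk (pathGraph n) w v) →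
                Unique (u ∷ vertices q) → toℕ u ≡ toℕ v + length (vertices q)
  falling-end {w = w} u≡1+w (stop _) _ = trans u≡1+w (+-comm 1 (toℕ w))
  falling-end {v = v} u≡1+w (step (inj₂ w≡1+w′) q) (_ ∷ q-path) =
    trans u≡1+w (trans (cong suc (falling-end w≡1+w′ q q-path)) (sym (+-suc (toℕ v) _)))
  falling-end u≡1+w (step (inj₁ w′≡1+w) q) ((_ ∷ u∉q) ∷ _) =
    ⊥-elim (All.lookup u∉q (first∈ q) (toℕ-injective (trans u≡1+w (sym w′≡1+w))))

  far-apart : ∀ {u v : Fin n} L → 2 ≤ L → toℕ v ≡ toℕ u + L → ¬ PathAdj u v
  far-apart {u} L _ v≡u+L (inj₂ u≡1+v) = m≢1+m+n (toℕ u) (trans u≡1+v (cong suc v≡u+L))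
  far-apart {u} (suc (suc L)) _ v≡u+L (inj₁ v≡1+u) =
    m≢1+m+n (toℕ u) (trans (suc-injective (trans (sym v≡1+u) (trans v≡u+L (+-suc (toℕ u) (suc L)))))
                           (+-suc (toℕ u) L))
  far-apart (suc zero) (s≤s ()) _ (inj₁ _)

  -- Pₙ is acyclic: the ends of a path with at least 3 vertices are at distance at least 2.
  pathGraph-acyclic : ¬ HasCycle (pathGraph n)
  pathGraph-acyclic (_ , _ , stop _ , _ , s≤s () , _)
  pathGraph-acyclic (_ , _ , step (inj₁ up) q , p-path , s≤s 2≤L , v~u) =
    far-apart _ 2≤L (rising-end up q p-path) (symm (pathGraph n) v~u)
  pathGraph-acyclic (_ , _ , step (inj₂ down) q , p-path , s≤s 2≤L , v~u) =
    far-apart _ 2≤L (falling-end down q p-path) v~u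

  vertex : ∀ m → m < n → Σ (Fin n) λ w → toℕ w ≡ m
  vertex m m<n = fromℕ< m<n , toℕ-fromℕ< m<n

  edgeColouring : ∀ {k} → (ℕ → Fin k) → EdgeColouring (pathGraph n) k
  edgeColouring f x y = f (toℕ x ⊓ toℕ y)

  module Monotone {k} (f : ℕ → Fin k) where

    private
      c : EdgeColouring (pathGraph n) k
      c = edgeColouring f

    colour-up : ∀ {x y : Fin n} → toℕ y ≡ suc (toℕ x) → c x y ≡ f (toℕ x)
    colour-up {x} y≡1+x = cong f (m≤n⇒m⊓n≡m (subst (toℕ x ≤_) (sym y≡1+x) (n≤1+n (toℕ x))))

    colour-down : ∀ {x y : Fin n} → toℕ x ≡ suc (toℕ y) → c x y ≡ f (toℕ y)
    colour-down {y = y} x≡1+y = cong f (m≥n⇒m⊓n≡n (subst (toℕ y ≤_) (sym x≡1+y) (n≤1+n (toℕ y))))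

    ascending : ∀ (u v : Fin n) d → toℕ v ≡ toℕ u + d →
      Σ (Walk (pathGraph n) u v) λ p →
        All (λ x → toℕ u ≤ toℕ x) (vertices p) × IsPath p × colours c p ≡ segment f (toℕ u) d
    ascending u v zero v≡u+0 with toℕ-injective {i = u} {j = v} (sym (trans v≡u+0 (+-identityʳ _)))
    ... | refl = stop u , ≤-refl ∷ [] , [] ∷ [] , refl
    ascending u v (suc d) v≡u+1+d with vertex (suc (toℕ u)) (≤-<-trans u<v (toℕ<n v))
      where
      u<v : toℕ u < toℕ v
      u<v = subst (toℕ u <_) (sym v≡u+1+d) (m<m+n (toℕ u) z<s)
    ... | w , w≡1+u with ascending w v d (trans v≡u+1+d (trans (+-suc (toℕ u) d) (cong (_+ d) (sym w≡1+u))))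
    ...   | p , above-w , p-path , p-colours =
      step (inj₁ w≡1+u) p ,
      ≤-refl ∷ All.map <⇒≤ above-u ,
      All.map (λ u<x u≡x → <-irrefl (cong toℕ u≡x) u<x) above-u ∷ p-path ,
      cong₂ _∷_ (colour-up w≡1+u) (trans p-colours (cong (λ i → segment f i d) w≡1+u))
      where
      above-u : All (λ x → toℕ u < toℕ x) (vertices p)
      above-u = All.map (λ {x} w≤x → subst (_≤ toℕ x) w≡1+u w≤x) above-w

    descending : ∀ (v u : Fin n) d → toℕ v ≡ toℕ u + d →
      Σ (Walk (pathGraph n) v u) λ p →
        All (λ x → toℕ x ≤ toℕ v) (vertices p) × IsPath p ×
        colours c p ≡ applyDownFrom (λ i → f (toℕ u + i)) d
    descending v u zero v≡u+0 with toℕ-injective {i = u} {j = v} (sym (trans v≡u+0 (+-identityʳ _)))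
    ... | refl = stop u , ≤-refl ∷ [] , [] ∷ [] , refl
    descending v u (suc d) v≡u+1+d with vertex (toℕ u + d) (<-trans u+d<v (toℕ<n v))
      where
      u+d<v : toℕ u + d < toℕ v
      u+d<v = subst (toℕ u + d <_) (sym (trans v≡u+1+d (+-suc (toℕ u) d))) (n<1+n (toℕ u + d))
    ... | w , w≡u+d with descending w u d w≡u+d
    ...   | p , below-w , p-path , p-colours =
      step (inj₂ v≡1+w) p ,
      ≤-refl ∷ All.map <⇒≤ below-v ,
      All.map (λ x<v v≡x → <-irrefl (sym (cong toℕ v≡x)) x<v) below-v ∷ p-path ,
      cong₂ _∷_ (trans (colour-down v≡1+w) (cong f w≡u+d)) p-colours
      where
      v≡1+w : toℕ v ≡ suc (toℕ w)
      v≡1+w = trans v≡u+1+d (trans (+-suc (toℕ u) d) (cong suc (sym w≡u+d)))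
      below-v : All (λ x → toℕ x < toℕ v) (vertices p)
      below-v = All.map (λ {x} x≤w → subst (toℕ x <_) (sym v≡1+w) (s≤s x≤w)) below-w

pathGraph-colourable : ∀ n K → 0 < K → n ≤ 2 ^ K → CFCColourable (pathGraph n) K
pathGraph-colourable n (suc k) _ n≤2^K = edgeColouring (ruler k) , well-defined , conflict-free
  where
  open Monotone (ruler k)

  well-defined : WellDefined {G = pathGraph n} (edgeColouring (ruler k))
  well-defined x y _ = cong (ruler k) (⊓-comm (toℕ x) (toℕ y))

  -- Vertex indices are at most rulerLength k, so the segments below fit into ruler k.
  in-ruler : ∀ (x : Fin n) → toℕ x ≤ rulerLength k
  in-ruler x = s≤s⁻¹ (≤-trans (toℕ<n x) (subst (n ≤_) (sym (rulerLength≡2^-1 k)) n≤2^K))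

  gap-positive : ∀ {x y : Fin n} d → x ≢ y → toℕ x + d ≡ toℕ y → 0 < d
  gap-positive zero    x≢y x+0≡y = ⊥-elim (x≢y (toℕ-injective (trans (sym (+-identityʳ _)) x+0≡y)))
  gap-positive (suc d) _   _     = z<s

  -- Go up or down from u to v; the colours on the way form a nonempty ruler segment.
  conflict-free : ∀ u v → u ≢ v → Σ (Walk (pathGraph n) u v) λ p →
                  IsPath p × ConflictFree (colours (edgeColouring (ruler k)) p)
  conflict-free u v u≢v with ≤-total (toℕ u) (toℕ v)
  ... | inj₁ u≤v with m≤n⇒∃[o]m+o≡n u≤v
  ...   | d , u+d≡v with ascending u v d (sym u+d≡v)
  ...     | p , _ , p-path , p-colours =
    p , p-path , subst (ConflictFree {suc k}) (sym p-colours)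
                       (ruler-conflict-free k (toℕ u) d (gap-positive d u≢v u+d≡v)
                                            (subst (_≤ rulerLength k) (sym u+d≡v) (in-ruler v)))
  conflict-free u v u≢v | inj₂ v≤u with m≤n⇒∃[o]m+o≡n v≤u
  ...   | d , v+d≡u with descending u v d (sym v+d≡u)
  ...     | p , _ , p-path , p-colours with ruler-conflict-free k (toℕ v) d (gap-positive d (u≢v ∘ sym) v+d≡u)
                                                   (subst (_≤ rulerLength k) (sym v+d≡u) (in-ruler u))
  ...       | t , once = p , p-path , t ,
    trans (cong (count t) p-colours) (trans (count-backwards t (ruler k) (toℕ v) d) once)

n≤2*⌈n/2⌉ : ∀ n → n ≤ 2 * ⌈ n /2⌉
n≤2*⌈n/2⌉ n = begin
  n                      ≡⟨ sym (⌊n/2⌋+⌈n/2⌉≡n n) ⟩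
  ⌊ n /2⌋ + ⌈ n /2⌉      ≤⟨ +-monoˡ-≤ ⌈ n /2⌉ (⌊n/2⌋≤⌈n/2⌉ n) ⟩
  ⌈ n /2⌉ + ⌈ n /2⌉      ≡⟨ cong (⌈ n /2⌉ +_) (sym (+-identityʳ ⌈ n /2⌉)) ⟩
  2 * ⌈ n /2⌉            ∎
  where open ≤-Reasoning

n≤2^⌈log₂n⌉ : ∀ n → n ≤ 2 ^ ⌈log₂ n ⌉
n≤2^⌈log₂n⌉ = <-rec (λ n → n ≤ 2 ^ ⌈log₂ n ⌉) bound
  where
  bound : ∀ n → (∀ {m} → m < n → m ≤ 2 ^ ⌈log₂ m ⌉) → n ≤ 2 ^ ⌈log₂ n ⌉
  bound zero          _   = z≤n
  bound (suc zero)    _   = s≤s z≤n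
  bound (suc (suc m)) rec = begin
    suc (suc m)                  ≤⟨ n≤2*⌈n/2⌉ (suc (suc m)) ⟩
    2 * suc ⌈ m /2⌉              ≤⟨ *-monoʳ-≤ 2 (rec (⌈n/2⌉<n m)) ⟩
    2 * 2 ^ ⌈log₂ suc ⌈ m /2⌉ ⌉   ≡⟨ cong (λ e → 2 ^ suc e) (⌈log₂⌈n/2⌉⌉≡⌈log₂n⌉∸1 (suc (suc m))) ⟩
    2 ^ ⌈log₂ suc (suc m) ⌉      ∎
    where open ≤-Reasoning

⌈log₂⌉-least : ∀ {n K} → n ≤ 2 ^ K → ⌈log₂ n ⌉ ≤ K
⌈log₂⌉-least {K = K} n≤2^K = subst (_ ≤_) (⌈log₂2^n⌉≡n K) (⌈log₂⌉-mono-≤ n≤2^K)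

⌈log₂⌉-positive : ∀ {n} → 2 ≤ n → 0 < ⌈log₂ n ⌉
⌈log₂⌉-positive {n} 2≤n = subst (_≤ ⌈log₂ n ⌉) (⌈log₂2^n⌉≡n 1) (⌈log₂⌉-mono-≤ 2≤n)

theorem2p5 : (n : ℕ) → 2 ≤ n → (T : Graph n) → IsTree T →
    IsCfc (pathGraph n) ⌈log₂ n ⌉ ×
    (∀ k m → IsCfc T k → IsCfc (pathGraph n) m → m ≤ k)
theorem2p5 n 2≤n T (_ , T-acyclic) = (path-colourable , path-minimal) , path≤tree
  where
  log-bound : ∀ {G : Graph n} → ¬ HasCycle G → ∀ k → CFCColourable G k → ⌈log₂ n ⌉ ≤ k
  log-bound acyclic k colourable = ⌈log₂⌉-least (acyclic-cfc-bound acyclic colourable)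

  path-colourable : CFCColourable (pathGraph n) ⌈log₂ n ⌉
  path-colourable = pathGraph-colourable n ⌈log₂ n ⌉ (⌈log₂⌉-positive 2≤n) (n≤2^⌈log₂n⌉ n)

  path-minimal : ∀ k → CFCColourable (pathGraph n) k → ⌈log₂ n ⌉ ≤ k
  path-minimal = log-bound pathGraph-acyclic

  path≤tree : ∀ k m → IsCfc T k → IsCfc (pathGraph n) m → m ≤ k
  path≤tree k m (T-colourable , _) (_ , m-minimal) =
    ≤-trans (m-minimal ⌈log₂ n ⌉ path-colourable) (log-bound T-acyclic k T-colourable)
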